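{- For every positive integer $n$, during a complete run of $\mathrm{RuleDesc}(n)$, the write statements executed after initialisation are "$d_k\leftarrow m$" (inside the last inner loop) and "$d_k\leftarrow n'$". Together they are executed a total of exactly $\sum_{x=1}^{n}p(x) - 1$ times.
   Context: $p(n)$ denotes the number of partitions of $n$. The procedure $\mathrm{RuleDesc}(n)$, for $n>0$, operates on an array $d$ as follows and visits every descending composition of $n$ (a sequence of positive integers in nonincreasing order summing to $n$) exactly once, in reverse lexicographic order: 1. Initialisation: $d_1\leftarrow n$; $k\leftarrow 1$; visit $\langle d_1\rangle$. 2. While $k\ne n$: - $\ell\leftarrow k$; $m\leftarrow d_k$. - While $m=1$: $k\leftarrow k-1$; $m\leftarrow d_k$. - $n'\leftarrow m+\ell-k$; $m\leftarrow m-1$. - While $m<n'$: $d_k\leftarrow m$; $n'\leftarrow n'-m$; $k\leftarrow k+1$. - $d_k\leftarrow n'$; visit $\langle d_1,\dots,d_k\rangle$. -}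

module Defs where

open import Data.Nat using (ℕ; zero; suc; _+_; _∸_; _<_; _≥_; _≟_; _<?_)
open import Data.Nat.Properties using (_≥?_)
open import Data.Nat.ListAction using (sum)
open import Data.List using (List; []; _∷_; map; length; filter; concatMap; applyUpTo; _++_)
open import Data.List.Relation.Unary.Linked using (Linked; linked?)
open import Data.Bool using (Bool; true; false; if_then_else_)
open import Relation.Nullary using (Dec; yes; no)
open import Relation.Nullary.Decidable using (_×-dec_; ⌊_⌋)
open import Data.Product using (_×_)
open import Relation.Binary.PropositionalEquality using (_≡_)

IsPartition : ℕ → List ℕ → Set
IsPartition n xs = (sum xs ≡ n) × Linked _≥_ xs

listsOf : ℕ → ℕ → List (List ℕ)
listsOf zero    mx = [] ∷ []
listsOf (suc l) mx = concatMap (λ x → map (x ∷_) (listsOf l mx)) (applyUpTo suc mx)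

-- all lists of length ≤ n with entries in {1,…,n}: a superset of the
-- partitions of n, each list occurring exactly once
candidates : ℕ → List (List ℕ)
candidates n = concatMap (λ l → listsOf l n) (applyUpTo (λ i → i) (suc n))

isPartition? : (n : ℕ) → (xs : List ℕ) → Dec (IsPartition n xs)
isPartition? n xs = (sum xs ≟ n) ×-dec linked? _≥?_ xs

p : ℕ → ℕ
p n = length (filter (isPartition? n) (candidates n))

sumP : ℕ → ℕ
sumP n = sum (map p (applyUpTo suc n))

-- The procedure RuleDesc(n) as a small-step machine.
-- The array d is 1-indexed, modelled as a function ℕ → ℕ.

data PC : Set where
  outer  : PC   -- test of "while k ≠ n"
  loop1  : PC   -- test of "while m = 1"
  loop2  : PC   -- test of "while m < n'"
  done   : PC

record St : Set where
  constructor st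
  field
    pc     : PC
    nn     : ℕ         -- the input n
    d      : ℕ → ℕ
    k      : ℕ
    ℓ      : ℕ
    m      : ℕ
    n′     : ℕ
    writes : ℕ         -- number of executions of "d_k ← m" / "d_k ← n'"
open St public

update : (ℕ → ℕ) → ℕ → ℕ → (ℕ → ℕ)
update f i v j = if ⌊ j ≟ i ⌋ then v else f j

-- Initialisation: d_1 ← n; k ← 1 (not counted among the writes)
init : ℕ → St
init n = st outer n (update (λ _ → 0) 1 n) 1 0 0 0 0

step : St → St
step (st outer n d k l m n' w) with k ≟ n
... | yes _ = st done n d k l m n' w
... | no  _ = st loop1 n d k k (d k) n' w
step (st loop1 n d k l m n' w) with m ≟ 1
... | yes _ = st loop1 n d (k ∸ 1) l (d (k ∸ 1)) n' w
... | no  _ = st loop2 n d k l (m ∸ 1) ((m + l) ∸ k) w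
step (st loop2 n d k l m n' w) with m <? n'
... | yes _ = st loop2 n (update d k m) (suc k) l m (n' ∸ m) (suc w)
... | no  _ = st outer n (update d k n') k l m n' (suc w)
step (st done n d k l m n' w) = st done n d k l m n' w

run : ℕ → St → St
run zero    s = s
run (suc t) s = run t (step s)

module Submission where

-- Call a nonempty nonincreasing sequence of positive integers with sum at
-- most n a node: the nodes are exactly the nonempty prefixes of partitions of n (pad a prefix
-- with ones), and there are ∑_{x=1}^{n} p(x) of them.  RuleDesc(n) writes every node except ⟨n⟩
-- (which is written at initialisation) exactly once, which is the statement.
--
-- With P L a s the number of partitions of s into at most L parts ≤ a, and
--     nodes a r the number of nonincreasing sequences with parts ≤ a and sum ≤ r, we show
--     sumP n ≡ nodes n n, by relating the enumeration defining p in Defs to P, and the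
--     recursion nodes b r ≡ 1 + nodes b (r ∸ b) + nodes (b ∸ 1) r for 1 ≤ b ≤ r.
-- (2) Simulation.  We relate machine states to the partition shown in d₁ … d_k (Displays),
--     analyse the three inner phases (fill, skip-ones, descend), and prove by a mutual
--     induction (enumerate, advance) that enumerating all completions of a prefix costs exactly
--     the number of writes dictated by the recursion for nodes.

open import Defs
open import Data.Nat using (ℕ; zero; suc; _+_; _∸_; _<_; _≤_; _≥_; _⊓_; z≤n; s≤s; _≤ᵇ_; _≡ᵇ_)
open import Data.Nat.Properties
open import Data.Nat.ListAction using (sum)
open import Data.Nat.ListAction.Properties using (sum-++)
open import Data.List using (List; []; _∷_; map; length; filter; concatMap; applyUpTo; _++_; replicate)
open import Data.List.Properties using (length-++; length-replicate; ++-assoc)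
open import Data.List.Relation.Unary.Linked using (Linked; [-]; _∷_)
import Data.List.Relation.Unary.Linked as Linked
open import Data.List.Relation.Unary.All using (All; []; _∷_)
open import Data.List.Relation.Unary.All.Properties using (++⁺)
open import Data.Bool using (Bool; true; false; if_then_else_; _∧_; T)
open import Data.Bool.Properties using (T-∧)
open import Data.Unit using (⊤; tt)
open import Data.Empty using (⊥-elim)
open import Relation.Nullary using (Dec; yes; no; does; proof; ¬_)
open import Relation.Nullary.Reflects using (det; fromEquivalence)
open import Data.Product using (∃-syntax; _×_; _,_; proj₁; proj₂; Σ)
open import Function.Bundles using (Equivalence)
open import Algebra.Properties.CommutativeSemigroup +-commutativeSemigroup
  using (interchange; x∙yz≈y∙xz; x∙yz≈yx∙z; xy∙z≈xz∙y)
open import Relation.Binary.PropositionalEquality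

Σ< : ℕ → (ℕ → ℕ) → ℕ
Σ< zero    f = 0
Σ< (suc n) f = f 0 + Σ< n (λ i → f (suc i))

Σ<-cong : ∀ n {f g : ℕ → ℕ} → (∀ i → i < n → f i ≡ g i) → Σ< n f ≡ Σ< n g
Σ<-cong zero    eq = refl
Σ<-cong (suc n) eq = cong₂ _+_ (eq 0 (s≤s z≤n)) (Σ<-cong n (λ i i<n → eq (suc i) (s≤s i<n)))

Σ<-zero : ∀ n → Σ< n (λ _ → 0) ≡ 0
Σ<-zero zero    = refl
Σ<-zero (suc n) = Σ<-zero n

Σ<-+ : ∀ n (f g : ℕ → ℕ) → Σ< n (λ i → f i + g i) ≡ Σ< n f + Σ< n g
Σ<-+ zero    f g = refl
Σ<-+ (suc n) f g =
  trans (cong (f 0 + g 0 +_) (Σ<-+ n (λ i → f (suc i)) (λ i → g (suc i)))) (interchange (f 0) (g 0) _ _)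

Σ<-snoc : ∀ n f → Σ< (suc n) f ≡ Σ< n f + f n
Σ<-snoc zero    f = +-comm (f 0) 0
Σ<-snoc (suc n) f = trans (cong (f 0 +_) (Σ<-snoc n (λ i → f (suc i)))) (sym (+-assoc (f 0) _ _))

Σ<-swap : ∀ m n (g : ℕ → ℕ → ℕ) → Σ< m (λ l → Σ< n (g l)) ≡ Σ< n (λ i → Σ< m (λ l → g l i))
Σ<-swap zero    n g = sym (Σ<-zero n)
Σ<-swap (suc m) n g =
  trans (cong (Σ< n (g 0) +_) (Σ<-swap m n (λ l → g (suc l)))) (sym (Σ<-+ n (g 0) _))

Σ<-prefix : ∀ m k (h : ℕ → ℕ) → k ≤ m → Σ< m (λ i → if suc i ≤ᵇ k then h i else 0) ≡ Σ< k h
Σ<-prefix m       zero    h _         = Σ<-zero m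
Σ<-prefix (suc m) (suc k) h (s≤s k≤m) = cong (h 0 +_) (Σ<-prefix m k (λ i → h (suc i)) k≤m)

sum-applyUpTo : ∀ (f h : ℕ → ℕ) n → sum (map f (applyUpTo h n)) ≡ Σ< n (λ i → f (h i))
sum-applyUpTo f h zero    = refl
sum-applyUpTo f h (suc n) = cong (f (h 0) +_) (sum-applyUpTo f (λ i → h (suc i)) n)

-- δ₀ s is 1 if s = 0 and 0 otherwise: the number of partitions of s into no parts.
δ₀ : ℕ → ℕ
δ₀ s = if s ≡ᵇ 0 then 1 else 0

-- P L a s: the number of partitions of s into at most L parts, each at most a.
-- A nonempty one is its first part i+1 ≤ a ⊓ s followed by a partition of s ∸ (i+1) into
-- parts at most i+1.
P : ℕ → ℕ → ℕ → ℕ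
P zero    a s = δ₀ s
P (suc L) a s = δ₀ s + Σ< (a ⊓ s) (λ i → P L (suc i) (s ∸ suc i))

-- N L a r: the number of nonempty nonincreasing sequences of at most L positive parts, each
-- at most a, with sum at most r (same decomposition by the first part).
N : ℕ → ℕ → ℕ → ℕ
N zero    a r = 0
N (suc L) a r = Σ< (a ⊓ r) (λ i → suc (N L (suc i) (r ∸ suc i)))

-- nodes a r: the number of nonempty nonincreasing sequences with parts at most a and sum at
-- most r (their length is at most r anyway); nodes n n counts the nodes of the strategy.
nodes : ℕ → ℕ → ℕ
nodes a r = N r a r

P-zero : ∀ L a → P L a 0 ≡ 1
P-zero zero    a = refl
P-zero (suc L) a rewrite ⊓-zeroʳ a = refl

N-zero : ∀ L a → N L a 0 ≡ 0
N-zero zero    a = refl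
N-zero (suc L) a rewrite ⊓-zeroʳ a = refl

N-bound : ∀ L L' a r → r ≤ L → r ≤ L' → N L a r ≡ N L' a r
N-bound L L' a zero _ _ = trans (N-zero L a) (sym (N-zero L' a))
N-bound (suc L) (suc L') a (suc r) (s≤s r≤L) (s≤s r≤L') =
  Σ<-cong (a ⊓ suc r) (λ i _ → cong suc
    (N-bound L L' (suc i) (r ∸ i) (≤-trans (m∸n≤m r i) r≤L) (≤-trans (m∸n≤m r i) r≤L')))

P-bound : ∀ L L' a a' s → s ≤ L → s ≤ L' → a ⊓ s ≡ a' ⊓ s → P L a s ≡ P L' a' s
P-bound L L' a a' zero _ _ _ = trans (P-zero L a) (sym (P-zero L' a'))
P-bound (suc L) (suc L') a a' (suc s) (s≤s s≤L) (s≤s s≤L') a⊓s≡a'⊓s = begin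
  Σ< (a ⊓ suc s) (λ i → P L (suc i) (s ∸ i))
    ≡⟨ cong (λ c → Σ< c (λ i → P L (suc i) (s ∸ i))) a⊓s≡a'⊓s ⟩
  Σ< (a' ⊓ suc s) (λ i → P L (suc i) (s ∸ i))
    ≡⟨ Σ<-cong (a' ⊓ suc s) (λ i _ → P-bound L L' (suc i) (suc i) (s ∸ i)
         (≤-trans (m∸n≤m s i) s≤L) (≤-trans (m∸n≤m s i) s≤L') refl) ⟩
  Σ< (a' ⊓ suc s) (λ i → P L' (suc i) (s ∸ i)) ∎
  where open ≡-Reasoning

N-step : ∀ L a r → N L a (suc r) ≡ N L a r + P L a (suc r)

N-step-first : ∀ L r i → i < r →
  suc (N L (suc i) (r ∸ i)) ≡ suc (N L (suc i) (r ∸ suc i)) + P L (suc i) (r ∸ i)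
N-step-first L r i i<r rewrite +-∸-assoc 1 i<r = cong suc (N-step L (suc i) (r ∸ suc i))

-- If a ≤ r the possible first parts stay 1‥a; otherwise r+1 becomes a new first part, which
-- contributes the single new sequence ⟨r+1⟩ and the single new partition ⟨r+1⟩.
N-step zero    a r = refl
N-step (suc L) a r with a ≤? r
... | yes a≤r rewrite m≤n⇒m⊓n≡m (m≤n⇒m≤1+n a≤r) | m≤n⇒m⊓n≡m a≤r =
  trans (Σ<-cong a (λ i i<a → N-step-first L r i (<-≤-trans i<a a≤r))) (Σ<-+ a _ _)
... | no a≰r rewrite m≥n⇒m⊓n≡n (≰⇒> a≰r) | m≥n⇒m⊓n≡n (<⇒≤ (≰⇒> a≰r)) = begin
  Σ< (suc r) new                 ≡⟨ Σ<-snoc r new ⟩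
  Σ< r new + new r               ≡⟨ cong₂ _+_ (Σ<-cong r (N-step-first L r)) new-last ⟩
  Σ< r (λ i → old i + part i) + 1 ≡⟨ cong (_+ 1) (Σ<-+ r old part) ⟩
  Σ< r old + Σ< r part + 1       ≡⟨ +-assoc (Σ< r old) (Σ< r part) 1 ⟩
  Σ< r old + (Σ< r part + 1)     ≡⟨ cong (λ x → Σ< r old + (Σ< r part + x)) (sym part-last) ⟩
  Σ< r old + (Σ< r part + part r) ≡⟨ cong (Σ< r old +_) (sym (Σ<-snoc r part)) ⟩
  Σ< r old + Σ< (suc r) part     ∎
  where
  open ≡-Reasoning
  new old part : ℕ → ℕ
  new  i = suc (N L (suc i) (r ∸ i))
  old  i = suc (N L (suc i) (r ∸ suc i))
  part i = P L (suc i) (r ∸ i)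
  new-last : new r ≡ 1
  new-last = trans (cong (λ x → suc (N L (suc r) x)) (n∸n≡0 r)) (cong suc (N-zero L (suc r)))
  part-last : part r ≡ 1
  part-last = trans (cong (P L (suc r)) (n∸n≡0 r)) (P-zero L (suc r))

N-sum : ∀ L a r → N L a r ≡ Σ< r (λ i → P L a (suc i))
N-sum L a zero    = N-zero L a
N-sum L a (suc r) = begin
  N L a (suc r)                              ≡⟨ N-step L a r ⟩
  N L a r + P L a (suc r)                    ≡⟨ cong (_+ P L a (suc r)) (N-sum L a r) ⟩
  Σ< r (λ i → P L a (suc i)) + P L a (suc r) ≡⟨ Σ<-snoc r (λ i → P L a (suc i)) ⟨
  Σ< (suc r) (λ i → P L a (suc i))           ∎
  where open ≡-Reasoning

-- Parts are at most the sum, so only a ⊓ r matters.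
nodes-cap : ∀ a a' r → a ⊓ r ≡ a' ⊓ r → nodes a r ≡ nodes a' r
nodes-cap a a' zero    _         = refl
nodes-cap a a' (suc r) a⊓r≡a'⊓r = cong (λ c → Σ< c (λ i → suc (N r (suc i) (r ∸ i)))) a⊓r≡a'⊓r

-- Only the sequences 1, 11, …, 1ʳ have parts at most 1.
nodes-one : ∀ r → nodes 1 r ≡ r
nodes-one zero    = refl
nodes-one (suc r) = cong suc (trans (+-identityʳ _) (nodes-one r))

-- The recursion of the enumeration: for 1 ≤ b ≤ r, a sequence with parts ≤ b and sum ≤ r is
-- either the single part b, or b followed by a sequence with parts ≤ b and sum ≤ r ∸ b, or a
-- sequence with parts ≤ b ∸ 1.
nodes-split : ∀ b r → 1 ≤ b → b ≤ r → nodes b r ≡ suc (nodes b (r ∸ b) + nodes (b ∸ 1) r)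
nodes-split (suc b) (suc r) _ (s≤s b≤r) rewrite m≤n⇒m⊓n≡m b≤r | m≤n⇒m⊓n≡m (m≤n⇒m≤1+n b≤r) = begin
  Σ< (suc b) first                                ≡⟨ Σ<-snoc b first ⟩
  Σ< b first + suc (N r (suc b) (r ∸ b))          ≡⟨ cong (λ x → Σ< b first + suc x) shorter ⟩
  Σ< b first + suc (nodes (suc b) (r ∸ b))        ≡⟨ +-suc (Σ< b first) _ ⟩
  suc (Σ< b first + nodes (suc b) (r ∸ b))        ≡⟨ cong suc (+-comm (Σ< b first) _) ⟩
  suc (nodes (suc b) (r ∸ b) + Σ< b first)        ∎
  where
  open ≡-Reasoning
  first : ℕ → ℕ
  first i = suc (N r (suc i) (r ∸ i))
  shorter : N r (suc b) (r ∸ b) ≡ N (r ∸ b) (suc b) (r ∸ b)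
  shorter = N-bound r (r ∸ b) (suc b) (r ∸ b) (m∸n≤m r b) ≤-refl

nodes-last : ∀ a r → 1 ≤ r → r ≤ a → nodes a r ≡ suc (nodes (r ∸ 1) r)
nodes-last a r 1≤r r≤a = begin
  nodes a r                                 ≡⟨ nodes-cap a r r (trans (m≥n⇒m⊓n≡n r≤a) (sym (⊓-idem r))) ⟩
  nodes r r                                 ≡⟨ nodes-split r r 1≤r ≤-refl ⟩
  suc (nodes r (r ∸ r) + nodes (r ∸ 1) r)  ≡⟨ cong (λ x → suc (nodes r x + nodes (r ∸ 1) r)) (n∸n≡0 r) ⟩
  suc (nodes (r ∸ 1) r)                     ∎
  where open ≡-Reasoning

-- The write count of one "move a part a into the prefix" step of the enumeration.
nodes-more : ∀ a r {w l} → 1 ≤ a → a < r → w + l ≡ nodes a (r ∸ a) →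
  w + nodes (a ∸ 1) r + suc l ≡ nodes a r
nodes-more a r {w} {l} 1≤a a<r w+l≡ = begin
  w + nodes (a ∸ 1) r + suc l              ≡⟨ +-suc _ l ⟩
  suc (w + nodes (a ∸ 1) r + l)            ≡⟨ cong suc (xy∙z≈xz∙y w _ l) ⟩
  suc (w + l + nodes (a ∸ 1) r)            ≡⟨ cong (λ x → suc (x + nodes (a ∸ 1) r)) w+l≡ ⟩
  suc (nodes a (r ∸ a) + nodes (a ∸ 1) r)  ≡⟨ nodes-split a r 1≤a (<⇒≤ a<r) ⟨
  nodes a r                                 ∎
  where open ≡-Reasoning

count : (List ℕ → Bool) → List (List ℕ) → ℕ
count f []         = 0
count f (xs ∷ xss) = (if f xs then 1 else 0) + count f xss

length-filter≡count : ∀ {Q : List ℕ → Set} (Q? : ∀ xs → Dec (Q xs)) (f : List ℕ → Bool) →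
  (∀ xs → does (Q? xs) ≡ f xs) → ∀ xss → length (filter Q? xss) ≡ count f xss
length-filter≡count Q? f agree []         = refl
length-filter≡count Q? f agree (xs ∷ xss) rewrite agree xs with f xs
... | true  = cong suc (length-filter≡count Q? f agree xss)
... | false = length-filter≡count Q? f agree xss

count-++ : ∀ f xss yss → count f (xss ++ yss) ≡ count f xss + count f yss
count-++ f []         yss = refl
count-++ f (xs ∷ xss) yss = trans (cong (_ +_) (count-++ f xss yss)) (sym (+-assoc (if f xs then 1 else 0) _ _))

count-concatMap : ∀ f (g : ℕ → List (List ℕ)) (h : ℕ → ℕ) n →
  count f (concatMap g (applyUpTo h n)) ≡ Σ< n (λ i → count f (g (h i)))
count-concatMap f g h zero    = refl
count-concatMap f g h (suc n) =
  trans (count-++ f (g (h 0)) _) (cong (count f (g (h 0)) +_) (count-concatMap f g (λ i → h (suc i)) n))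

count-map-cons : ∀ f y xss → count f (map (y ∷_) xss) ≡ count (λ ys → f (y ∷ ys)) xss
count-map-cons f y []         = refl
count-map-cons f y (xs ∷ xss) = cong (_ +_) (count-map-cons f y xss)

count-guard : ∀ c g xss → count (λ ys → c ∧ g ys) xss ≡ (if c then count g xss else 0)
count-guard true  g xss        = refl
count-guard false g []         = refl
count-guard false g (xs ∷ xss) = count-guard false g xss

fits : ℕ → ℕ → List ℕ → Bool
fits s b []       = s ≡ᵇ 0
fits s b (y ∷ ys) = (y ≤ᵇ b ⊓ s) ∧ fits (s ∸ y) y ys

fits-sound : ∀ s b xs → T (fits s b xs) → sum xs ≡ s × Linked _≥_ (b ∷ xs)
fits-sound s b []       t = sym (≡ᵇ⇒≡ s 0 t) , [-]
fits-sound s b (y ∷ ys) t with Equivalence.to T-∧ t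
... | y≤ᵇb⊓s , rest with fits-sound (s ∸ y) y ys rest | ≤ᵇ⇒≤ y (b ⊓ s) y≤ᵇb⊓s
... | sum≡ , linked | y≤b⊓s =
  trans (cong (y +_) sum≡) (m+[n∸m]≡n (m≤n⊓o⇒m≤o b s y≤b⊓s)) , m≤n⊓o⇒m≤n b s y≤b⊓s ∷ linked

fits-complete : ∀ b xs → Linked _≥_ (b ∷ xs) → T (fits (sum xs) b xs)
fits-complete b []       _               = _
fits-complete b (y ∷ ys) (y≤b ∷ linked) = Equivalence.from T-∧
  ( ≤⇒≤ᵇ (⊓-glb y≤b (m≤m+n y (sum ys)))
  , subst (λ s → T (fits s y ys)) (sym (m+n∸m≡n y (sum ys))) (fits-complete y ys linked))

linked-sum : ∀ xs → Linked _≥_ xs → Linked _≥_ (sum xs ∷ xs)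
linked-sum []       _      = [-]
linked-sum (y ∷ ys) linked = m≤m+n y (sum ys) ∷ linked

isPartition≡fits : ∀ x xs → does (isPartition? x xs) ≡ fits x x xs
isPartition≡fits x xs = det (proof (isPartition? x xs)) (fromEquivalence sound complete)
  where
  sound : T (fits x x xs) → IsPartition x xs
  sound t = let sum≡ , linked = fits-sound x x xs t in sum≡ , Linked.tail linked
  complete : IsPartition x xs → T (fits x x xs)
  complete (refl , linked) = fits-complete (sum xs) xs (linked-sum xs linked)

count-listsOf-suc : ∀ l mx b s → b ⊓ s ≤ mx → count (fits s b) (listsOf (suc l) mx) ≡
  Σ< (b ⊓ s) (λ i → count (fits (s ∸ suc i) (suc i)) (listsOf l mx))
count-listsOf-suc l mx b s b⊓s≤mx = begin
  count (fits s b) (listsOf (suc l) mx)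
    ≡⟨ count-concatMap (fits s b) (λ x → map (x ∷_) (listsOf l mx)) suc mx ⟩
  Σ< mx (λ i → count (fits s b) (map (suc i ∷_) (listsOf l mx)))
    ≡⟨ Σ<-cong mx (λ i _ → trans (count-map-cons (fits s b) (suc i) (listsOf l mx))
                                 (count-guard (suc i ≤ᵇ b ⊓ s) _ (listsOf l mx))) ⟩
  Σ< mx (λ i → if suc i ≤ᵇ b ⊓ s then count (fits (s ∸ suc i) (suc i)) (listsOf l mx) else 0)
    ≡⟨ Σ<-prefix mx (b ⊓ s) _ b⊓s≤mx ⟩
  Σ< (b ⊓ s) (λ i → count (fits (s ∸ suc i) (suc i)) (listsOf l mx)) ∎
  where open ≡-Reasoning

count-fits : ∀ L mx b s → b ≤ mx → Σ< (suc L) (λ l → count (fits s b) (listsOf l mx)) ≡ P L b s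
count-fits zero    mx b s _    = trans (+-identityʳ _) (+-identityʳ _)
count-fits (suc L) mx b s b≤mx = begin
  count (fits s b) (listsOf 0 mx) + Σ< (suc L) (λ l → count (fits s b) (listsOf (suc l) mx))
    ≡⟨ cong₂ _+_ (+-identityʳ (δ₀ s)) (Σ<-cong (suc L) (λ l _ → count-listsOf-suc l mx b s b⊓s≤mx)) ⟩
  δ₀ s + Σ< (suc L) (λ l → Σ< (b ⊓ s) (λ i → count (fits (s ∸ suc i) (suc i)) (listsOf l mx)))
    ≡⟨ cong (δ₀ s +_) (Σ<-swap (suc L) (b ⊓ s) (λ l i → count (fits (s ∸ suc i) (suc i)) (listsOf l mx))) ⟩
  δ₀ s + Σ< (b ⊓ s) (λ i → Σ< (suc L) (λ l → count (fits (s ∸ suc i) (suc i)) (listsOf l mx)))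
    ≡⟨ cong (δ₀ s +_) (Σ<-cong (b ⊓ s) (λ i i<b⊓s →
         count-fits L mx (suc i) (s ∸ suc i) (≤-trans (<-≤-trans i<b⊓s (m⊓n≤m b s)) b≤mx))) ⟩
  δ₀ s + Σ< (b ⊓ s) (λ i → P L (suc i) (s ∸ suc i)) ∎
  where
  open ≡-Reasoning
  b⊓s≤mx : b ⊓ s ≤ mx
  b⊓s≤mx = ≤-trans (m⊓n≤m b s) b≤mx

p≡P : ∀ x → p x ≡ P x x x
p≡P x = begin
  p x
    ≡⟨ length-filter≡count (isPartition? x) (fits x x) (isPartition≡fits x) (candidates x) ⟩
  count (fits x x) (candidates x)
    ≡⟨ count-concatMap (fits x x) (λ l → listsOf l x) (λ i → i) (suc x) ⟩
  Σ< (suc x) (λ l → count (fits x x) (listsOf l x))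
    ≡⟨ count-fits x x x x ≤-refl ⟩
  P x x x ∎
  where open ≡-Reasoning

sumP≡nodes : ∀ n → sumP n ≡ nodes n n
sumP≡nodes n = begin
  sumP n                       ≡⟨ sum-applyUpTo p suc n ⟩
  Σ< n (λ i → p (suc i))       ≡⟨ Σ<-cong n (λ i i<n → trans (p≡P (suc i)) (P-bound (suc i) n (suc i) n (suc i)
                                    ≤-refl i<n (trans (⊓-idem (suc i)) (sym (m≥n⇒m⊓n≡n i<n))))) ⟩
  Σ< n (λ i → P n n (suc i))   ≡⟨ N-sum n n n ⟨
  nodes n n                    ∎
  where open ≡-Reasoning

_⟶⟨_⟩_ : St → ℕ → St → Set
s ⟶⟨ w ⟩ s' = Σ ℕ λ t → run t s ≡ s' × writes s' ≡ w + writes s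

run-+ : ∀ t u s → run (t + u) s ≡ run u (run t s)
run-+ zero    u s = refl
run-+ (suc t) u s = run-+ t u (step s)

⟶-refl : ∀ {s} → s ⟶⟨ 0 ⟩ s
⟶-refl = 0 , refl , refl

⟶-step : ∀ {s s'} w → step s ≡ s' → writes s' ≡ w + writes s → s ⟶⟨ w ⟩ s'
⟶-step w step≡ writes≡ = 1 , step≡ , writes≡

⟶-trans : ∀ {s₁ s₂ s₃ w₁ w₂} → s₁ ⟶⟨ w₁ ⟩ s₂ → s₂ ⟶⟨ w₂ ⟩ s₃ → s₁ ⟶⟨ w₁ + w₂ ⟩ s₃
⟶-trans {s₁} {w₁ = w₁} {w₂} (t , run≡₁ , writes≡₁) (u , run≡₂ , writes≡₂) =
  t + u , trans (run-+ t u s₁) (trans (cong (run u) run≡₁) run≡₂) ,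
  trans writes≡₂ (trans (cong (w₂ +_) writes≡₁) (x∙yz≈yx∙z w₂ w₁ (writes s₁)))

update-same : ∀ f i v → update f i v i ≡ v
update-same f i v with i ≟ i
... | yes _   = refl
... | no  i≢i = ⊥-elim (i≢i refl)

update-other : ∀ f i v j → j ≢ i → update f i v j ≡ f j
update-other f i v j j≢i with j ≟ i
... | yes j≡i = ⊥-elim (j≢i j≡i)
... | no  _   = refl

Holds : (ℕ → ℕ) → ℕ → List ℕ → Set
Holds d j []       = ⊤
Holds d j (x ∷ xs) = d j ≡ x × Holds d (suc j) xs

Holds-++ˡ : ∀ {d} j xs ys → Holds d j (xs ++ ys) → Holds d j xs
Holds-++ˡ j []       ys _              = tt
Holds-++ˡ j (x ∷ xs) ys (dj≡x , holds) = dj≡x , Holds-++ˡ (suc j) xs ys holds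

Holds-++ʳ : ∀ {d} j xs ys → Holds d j (xs ++ ys) → Holds d (j + length xs) ys
Holds-++ʳ {d} j []       ys holds       = subst (λ i → Holds d i ys) (sym (+-identityʳ j)) holds
Holds-++ʳ {d} j (x ∷ xs) ys (_ , holds) =
  subst (λ i → Holds d i ys) (sym (+-suc j (length xs))) (Holds-++ʳ (suc j) xs ys holds)

Holds-snoc : ∀ {d} j xs v i → i ≡ j + length xs → Holds d j xs → Holds (update d i v) j (xs ++ v ∷ [])
Holds-snoc {d} j [] v i i≡j+0 _ =
  subst (λ i → update d i v j ≡ v) (sym (trans i≡j+0 (+-identityʳ j))) (update-same d j v) , tt
Holds-snoc {d} j (x ∷ xs) v i i≡ (dj≡x , holds) =
  trans (update-other d i v j j≢i) dj≡x , Holds-snoc (suc j) xs v i (trans i≡ (+-suc j (length xs))) holds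
  where
  j≢i : j ≢ i
  j≢i j≡i = <⇒≢ (m<m+n j (s≤s z≤n)) (trans j≡i i≡)

-- GreedyFill c r L: L = c, c, …, c, r' (with r' ≤ c) is r written greedily with parts c.
-- This is what the inner loop "while m < n'" writes.
data GreedyFill (c : ℕ) : ℕ → List ℕ → Set where
  last : ∀ {r}   → r ≤ c → GreedyFill c r (r ∷ [])
  more : ∀ {r L} → c < r → GreedyFill c (r ∸ c) L → GreedyFill c r (c ∷ L)

fill-ones : ∀ {r L} → 1 ≤ r → GreedyFill 1 r L → L ≡ replicate r 1
fill-ones (s≤s z≤n) (last (s≤s z≤n))             = refl
fill-ones (s≤s z≤n) (more {suc r} (s≤s 1≤r) fill) = cong (1 ∷_) (fill-ones 1≤r fill)

length-snoc : ∀ (xs : List ℕ) x → length (xs ++ x ∷ []) ≡ suc (length xs)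
length-snoc xs x = trans (length-++ xs) (+-comm (length xs) 1)

length≤sum : ∀ xs → All (1 ≤_) xs → length xs ≤ sum xs
length≤sum []       []            = z≤n
length≤sum (x ∷ xs) (1≤x ∷ 1≤xs) = +-mono-≤ 1≤x (length≤sum xs 1≤xs)

sum-shift : ∀ P {a r} → a ≤ r → sum (P ++ a ∷ []) + (r ∸ a) ≡ sum P + r
sum-shift P {a} {r} a≤r = begin
  sum (P ++ a ∷ []) + (r ∸ a)  ≡⟨ cong (_+ (r ∸ a)) (sum-++ P (a ∷ [])) ⟩
  sum P + (a + 0) + (r ∸ a)    ≡⟨ cong (λ x → sum P + x + (r ∸ a)) (+-identityʳ a) ⟩
  sum P + a + (r ∸ a)          ≡⟨ +-assoc (sum P) a (r ∸ a) ⟩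
  sum P + (a + (r ∸ a))        ≡⟨ cong (sum P +_) (m+[n∸m]≡n a≤r) ⟩
  sum P + r                    ∎
  where open ≡-Reasoning

module Machine (n : ℕ) where

  outer-exit : ∀ {d k l m n' w} → k ≡ n → step (st outer n d k l m n' w) ≡ st done n d k l m n' w
  outer-exit {k = k} k≡n with k ≟ n
  ... | yes _   = refl
  ... | no  k≢n = ⊥-elim (k≢n k≡n)

  outer-continue : ∀ {d k l m n' w} → k ≢ n → step (st outer n d k l m n' w) ≡ st loop1 n d k k (d k) n' w
  outer-continue {k = k} k≢n with k ≟ n
  ... | yes k≡n = ⊥-elim (k≢n k≡n)
  ... | no  _   = refl

  loop1-skip : ∀ {d k l m n' w} → m ≡ 1 → step (st loop1 n d k l m n' w) ≡ st loop1 n d (k ∸ 1) l (d (k ∸ 1)) n' w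
  loop1-skip refl = refl

  loop1-exit : ∀ {d k l m n' w} → m ≢ 1 → step (st loop1 n d k l m n' w) ≡ st loop2 n d k l (m ∸ 1) ((m + l) ∸ k) w
  loop1-exit {m = m} m≢1 with m ≟ 1
  ... | yes m≡1 = ⊥-elim (m≢1 m≡1)
  ... | no  _   = refl

  loop2-continue : ∀ {d k l m n' w} → m < n' →
    step (st loop2 n d k l m n' w) ≡ st loop2 n (update d k m) (suc k) l m (n' ∸ m) (suc w)
  loop2-continue {m = m} {n'} m<n' with m <? n'
  ... | yes _   = refl
  ... | no  m≮n' = ⊥-elim (m≮n' m<n')

  loop2-exit : ∀ {d k l m n' w} → ¬ m < n' → step (st loop2 n d k l m n' w) ≡ st outer n (update d k n') k l m n' (suc w)
  loop2-exit {m = m} {n'} m≮n' with m <? n'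
  ... | yes m<n' = ⊥-elim (m≮n' m<n')
  ... | no  _    = refl

  Displays : St → List ℕ → Set
  Displays s xs = pc s ≡ outer × nn s ≡ n × Holds (d s) 1 xs × k s ≡ length xs

  -- The inner loop started with m = c, n' = r at position j = |P|+1 appends the greedy fill
  -- of r with parts c to P, one write per part, and returns to the outer test.  (The bound
  -- r ≤ fuel here, and a + r ≤ fuel below, only serve the termination check.)
  fill : ∀ fuel c r P {d j l w} → 1 ≤ c → 1 ≤ r → r ≤ fuel → j ≡ suc (length P) → Holds d 1 P →
    Σ (List ℕ) λ L → GreedyFill c r L × Σ St λ s' → st loop2 n d j l c r w ⟶⟨ length L ⟩ s' × Displays s' (P ++ L)
  fill zero c zero P _ () _ _ _
  fill (suc fuel) c r P {d} {j} 1≤c 1≤r r≤fuel j≡ holds with c <? r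
  ... | no c≮r =
    (r ∷ []) , last (≮⇒≥ c≮r) , _ , ⟶-step 1 (loop2-exit c≮r) refl ,
    refl , refl , Holds-snoc 1 P r j j≡ holds , trans j≡ (sym (length-snoc P r))
  ... | yes c<r
    with fill fuel c (r ∸ c) (P ++ c ∷ []) 1≤c (m<n⇒0<n∸m c<r) (≤-trans (∸-monoʳ-≤ r 1≤c) (∸-monoˡ-≤ 1 r≤fuel))
           (cong suc (trans j≡ (sym (length-snoc P c)))) (Holds-snoc 1 P c j j≡ holds)
  ... | L , greedy , s' , run , displays =
    (c ∷ L) , more c<r greedy , s' , ⟶-trans (⟶-step 1 (loop2-continue c<r) refl) run ,
    subst (Displays s') (++-assoc P (c ∷ []) L) displays

  skip-ones : ∀ i {d j k l n' w} → k ≡ j + i → Holds d (suc j) (replicate i 1) →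
    st loop1 n d k l (d k) n' w ⟶⟨ 0 ⟩ st loop1 n d j l (d j) n' w
  skip-ones zero    {j = j} k≡j+0 _ rewrite trans k≡j+0 (+-identityʳ j) = ⟶-refl
  skip-ones (suc i) {j = j} k≡ (d[j+1]≡1 , ones) =
    ⟶-trans (skip-ones i (trans k≡ (+-suc j i)) ones) (⟶-step 0 (loop1-skip d[j+1]≡1) refl)

  -- From P ++ b 1ⁱ with b ≥ 2 (not the last partition, as |P| + 1 + i < n) the machine
  -- skips the trailing ones and enters the inner loop with m = b - 1, n' = b + i.
  descend : ∀ P b i r {s} → 2 ≤ b → b + i ≡ r → All (1 ≤_) P → sum P + r ≡ n →
    Displays s (P ++ b ∷ replicate i 1) →
    s ⟶⟨ 0 ⟩ st loop2 n (d s) (suc (length P)) (k s) (b ∸ 1) r (writes s)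
  descend P b i r {st .outer .n arr K _ _ _ w} 2≤b refl P≥1 sum≡n (refl , refl , holds , K≡) =
    ⟶-trans (⟶-step 0 (outer-continue K≢n) refl)
      (⟶-trans (skip-ones i K≡j+i ones)
        (⟶-step 0 (trans (loop1-exit arr[j]≢1) (cong₂ (λ c r → st loop2 n arr j K c r w) (cong (_∸ 1) arr[j]≡b) n'≡b+i)) refl))
    where
    j : ℕ
    j = suc (length P)
    K≡j+i : K ≡ j + i
    K≡j+i = trans K≡ (trans (length-++ P) (trans (cong (λ x → length P + suc x) (length-replicate i)) (+-suc (length P) i)))
    arr[j]≡b : arr j ≡ b
    arr[j]≡b = proj₁ (Holds-++ʳ 1 P (b ∷ replicate i 1) holds)
    ones : Holds arr (suc j) (replicate i 1)
    ones = proj₂ (Holds-++ʳ 1 P (b ∷ replicate i 1) holds)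
    arr[j]≢1 : arr j ≢ 1
    arr[j]≢1 arr[j]≡1 = <⇒≢ 2≤b (sym (trans (sym arr[j]≡b) arr[j]≡1))
    n'≡b+i : (arr j + K) ∸ j ≡ b + i
    n'≡b+i = trans (cong₂ (λ x y → (x + y) ∸ j) arr[j]≡b K≡j+i) (trans (cong (_∸ j) (x∙yz≈y∙xz b j i)) (m+n∸m≡n j (b + i)))
    K≢n : K ≢ n
    K≢n = <⇒≢ (subst (K <_) sum≡n (subst (_≤ sum P + (b + i)) 2+|P|+i (+-mono-≤ (length≤sum P P≥1) (+-monoˡ-≤ i 2≤b))))
      where
      2+|P|+i : length P + (2 + i) ≡ suc K
      2+|P|+i = trans (+-suc (length P) (suc i)) (cong suc (trans (+-suc (length P) i) (sym K≡j+i)))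

  sum-positive : ∀ {b i r} → 2 ≤ b → b + i ≡ r → 1 ≤ r
  sum-positive (s≤s _) refl = s≤s z≤n

  Reaches : St → ℕ → List ℕ → Set
  Reaches s w xs = Σ St λ s' → s ⟶⟨ w ⟩ s' × Displays s' xs

  -- Displaying P followed by the greedy fill L of r with parts a, the
  -- machine visits all partitions P ++ Q with Q a partition of r into parts ≤ a, ending at
  -- P ++ 1ʳ; together with the |L| writes that produced L this costs nodes a r writes.
  enumerate : ∀ fuel P a r L {s} → a + r ≤ fuel → 1 ≤ a → 1 ≤ r → GreedyFill a r L → All (1 ≤_) P →
    sum P + r ≡ n → Displays s (P ++ L) → Σ ℕ λ w → w + length L ≡ nodes a r × Reaches s w (P ++ replicate r 1)

  advance : ∀ fuel P b i r {s} → (b ∸ 1) + r ≤ fuel → 2 ≤ b → b + i ≡ r → All (1 ≤_) P →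
    sum P + r ≡ n → Displays s (P ++ b ∷ replicate i 1) → Reaches s (nodes (b ∸ 1) r) (P ++ replicate r 1)
  advance fuel P b i r {s} bound 2≤b b+i≡r P≥1 sum≡n displays
    with fill r (b ∸ 1) r P (∸-monoˡ-≤ 1 2≤b) (sum-positive 2≤b b+i≡r) ≤-refl refl
           (Holds-++ˡ 1 P _ (proj₁ (proj₂ (proj₂ displays))))
  ... | L , greedy , s₁ , run₁ , displays₁
    with enumerate fuel P (b ∸ 1) r L bound (∸-monoˡ-≤ 1 2≤b) (sum-positive 2≤b b+i≡r) greedy P≥1 sum≡n displays₁
  ... | w , w+|L|≡ , s₂ , run₂ , displays₂ =
    s₂ , subst (s ⟶⟨_⟩ s₂) (trans (+-comm (length L) w) w+|L|≡)
           (⟶-trans (descend P b i r 2≤b b+i≡r P≥1 sum≡n displays) (⟶-trans run₁ run₂)) ,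
    displays₂

  enumerate fuel P (suc zero) r L {s} _ _ 1≤r greedy _ _ displays =
    0 , trans (cong length (fill-ones 1≤r greedy)) (trans (length-replicate r) (sym (nodes-one r))) ,
    s , ⟶-refl , subst (λ Q → Displays s (P ++ Q)) (fill-ones 1≤r greedy) displays
  enumerate fuel P a@(suc (suc _)) (suc zero) L _ _ _ (last _) _ _ displays =
    0 , sym (nodes-last a 1 (s≤s z≤n) (s≤s z≤n)) , _ , ⟶-refl , displays
  enumerate fuel P (suc (suc _)) (suc zero) L _ _ _ (more (s≤s ()) _) _ _ _
  enumerate zero P (suc (suc _)) r L () _ _ _ _ _ _
  enumerate (suc fuel) P a@(suc (suc _)) r@(suc (suc _)) L bound _ 1≤r (last r≤a) P≥1 sum≡n displays =
    let s' , run , displays' = advance fuel P r 0 r (≤-pred (≤-trans (+-monoˡ-≤ r r≤a) bound))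
                                 (s≤s (s≤s z≤n)) (+-identityʳ r) P≥1 sum≡n displays
    in nodes (r ∸ 1) r , trans (+-comm _ 1) (sym (nodes-last a r 1≤r r≤a)) , s' , run , displays'
  enumerate (suc fuel) P a@(suc (suc _)) r L {s} bound 1≤a _ (more {L = L₁} a<r greedy) P≥1 sum≡n displays
    with enumerate fuel (P ++ a ∷ []) a (r ∸ a) L₁
           (subst (_≤ fuel) (sym (m+[n∸m]≡n (<⇒≤ a<r))) (≤-pred (≤-trans (+-monoˡ-≤ r 1≤a) bound)))
           1≤a (m<n⇒0<n∸m a<r) greedy (++⁺ P≥1 (1≤a ∷ [])) (trans (sum-shift P (<⇒≤ a<r)) sum≡n)
           (subst (Displays s) (sym (++-assoc P (a ∷ []) L₁)) displays)
  ... | w₁ , w₁+|L₁|≡ , s₁ , run₁ , displays₁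
    with advance fuel P a (r ∸ a) r (≤-pred bound) (s≤s (s≤s z≤n)) (m+[n∸m]≡n (<⇒≤ a<r)) P≥1 sum≡n
           (subst (Displays s₁) (++-assoc P (a ∷ []) _) displays₁)
  ... | s₂ , run₂ , displays₂ =
    w₁ + nodes (a ∸ 1) r , nodes-more a r 1≤a a<r w₁+|L₁|≡ , s₂ , ⟶-trans run₁ run₂ , displays₂

  halt : ∀ {s} → Displays s (replicate n 1) → Σ St λ s' → s ⟶⟨ 0 ⟩ s' × pc s' ≡ done
  halt {st .outer .n _ _ _ _ _ _} (refl , refl , _ , k≡) =
    _ , ⟶-step 0 (outer-exit (trans k≡ (length-replicate n))) refl , refl

  complete-run : 1 ≤ n → Σ ℕ λ w → w + 1 ≡ nodes n n × Σ St λ s → init n ⟶⟨ w ⟩ s × pc s ≡ done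
  complete-run 1≤n with enumerate (n + n) [] n n (n ∷ []) ≤-refl 1≤n 1≤n (last ≤-refl) [] refl initial
    where
    initial : Displays (init n) (n ∷ [])
    initial = refl , refl , (update-same (λ _ → 0) 1 n , tt) , refl
  ... | w , w+1≡nodes , s , run , displays with halt displays
  ... | s' , stop , halted = w , w+1≡nodes , s' , subst (init n ⟶⟨_⟩ s') (+-identityʳ w) (⟶-trans run stop) , halted

theorem3p12 : (n : ℕ) → 0 < n →
    ∃[ t ] (pc (run t (init n)) ≡ done × writes (run t (init n)) ≡ sumP n ∸ 1)
theorem3p12 n 0<n with Machine.complete-run n 0<n
... | w , w+1≡nodes , s , (t , run≡ , writes≡) , halted = t , trans (cong pc run≡) halted , (begin
  writes (run t (init n))  ≡⟨ cong writes run≡ ⟩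
  writes s                 ≡⟨ writes≡ ⟩
  w + 0                    ≡⟨ +-identityʳ w ⟩
  w                        ≡⟨ m+n∸n≡m w 1 ⟨
  w + 1 ∸ 1                ≡⟨ cong (_∸ 1) (trans w+1≡nodes (sym (sumP≡nodes n))) ⟩
  sumP n ∸ 1               ∎)
  where open ≡-Reasoning
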